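{- Let $G$ be an internally 4-connected graph. Then every separation $\{A,B\}$ of $G$ of order at most $3$ has one side with strictly more vertices than the other. The set $\tau$ consisting of all oriented separations $(A,B)$ of $G$ of order at most $3$ with $|A|<|B|$ (i.e. every such separation oriented towards its larger side) is a 4-tangle in $G$, and it is the only 4-tangle in $G$.
   Context: All graphs are finite and simple. A separation of a graph $G$ is a set $\{A,B\}$ with $A\cup B=V(G)$ and no edge of $G$ between $A\setminus B$ and $B\setminus A$; its order is $|A\cap B|$. Its two orientations are the oriented separations $(A,B)$ and $(B,A)$. A $k$-tangle in $G$ is a set $\tau$ of oriented separations of order $<k$ that contains exactly one orientation of every separation of $G$ of order $<k$, and contains no three (not necessarily distinct) elements $(A_1,B_1),(A_2,B_2),(A_3,B_3)$ with $G[A_1]\cup G[A_2]\cup G[A_3]=G$. A graph $G$ is internally 4-connected if it is 3-connected, has more than four vertices, and for every set $S$ of three vertices such that $G-S$ is disconnected, $S$ is independent and $G-S$ has exactly two components, one of which is a single vertex. -}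

module Defs where

open import Data.Nat using (ℕ; _<_; _≤_)
open import Data.Bool using (Bool; true; false)
open import Data.Fin using (Fin)
open import Data.Fin.Subset using (Subset; _∈_; _∉_; _∩_; _∪_; ∁; ∣_∣; ⁅_⁆)
open import Data.Product using (Σ; ∃; _×_; _,_)
open import Data.Sum using (_⊎_)
open import Data.Empty using (⊥)
open import Relation.Nullary using (¬_)
open import Relation.Binary.PropositionalEquality using (_≡_)
open import Function.Bundles using (_⇔_)

record Graph (n : ℕ) : Set where
  field
    adj     : Fin n → Fin n → Bool
    symm    : ∀ u v → adj u v ≡ adj v u
    irrefl  : ∀ v → adj v v ≡ false

module _ {n : ℕ} (G : Graph n) where
  open Graph G

  Edge : Fin n → Fin n → Set
  Edge u v = adj u v ≡ true

  data Reach (U : Subset n) (x : Fin n) : Fin n → Set where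
    here : x ∈ U → Reach U x x
    step : ∀ {y z} → Reach U x y → z ∈ U → Edge y z → Reach U x z

  Connected : Subset n → Set
  Connected U = (∃ λ x → x ∈ U) × (∀ x y → x ∈ U → y ∈ U → Reach U x y)

  Minus : Subset n → Subset n
  Minus S = ∁ S

  Independent : Subset n → Set
  Independent S = ∀ u v → u ∈ S → v ∈ S → ¬ Edge u v

  -- G[U] has exactly two components, one of which is a single vertex:
  -- some v ∈ U has no neighbour in U, and U ∖ {v} is connected.
  TwoCompsOneTrivial : Subset n → Set
  TwoCompsOneTrivial U =
    ∃ λ v → v ∈ U × (∀ w → w ∈ U → ¬ Edge v w) × Connected (U ∩ ∁ ⁅ v ⁆)

  KConnected : ℕ → Set
  KConnected k = k < n × (∀ X → ∣ X ∣ < k → Connected (Minus X))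

  Internally4Connected : Set
  Internally4Connected =
    KConnected 3 × 4 < n ×
    (∀ S → ∣ S ∣ ≡ 3 → ¬ Connected (Minus S) →
       Independent S × TwoCompsOneTrivial (Minus S))

  IsSeparation : Subset n → Subset n → Set
  IsSeparation A B =
    (∀ v → v ∈ A ∪ B) ×
    (∀ u v → u ∈ A → u ∉ B → v ∈ B → v ∉ A → ¬ Edge u v)

  order : Subset n → Subset n → ℕ
  order A B = ∣ A ∩ B ∣

  Covers : Subset n → Subset n → Subset n → Set
  Covers A₁ A₂ A₃ =
    (∀ v → v ∈ A₁ ⊎ v ∈ A₂ ⊎ v ∈ A₃) ×
    (∀ u v → Edge u v →
       (u ∈ A₁ × v ∈ A₁) ⊎ (u ∈ A₂ × v ∈ A₂) ⊎ (u ∈ A₃ × v ∈ A₃))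

  OSepSet : Set₁
  OSepSet = Subset n → Subset n → Set

  IsTangle : ℕ → OSepSet → Set
  IsTangle k τ =
    (∀ A B → τ A B → IsSeparation A B × order A B < k) ×
    (∀ A B → IsSeparation A B → order A B < k →
       (τ A B ⊎ τ B A) × (τ A B → τ B A → A ≡ B)) ×
    (∀ A₁ B₁ A₂ B₂ A₃ B₃ → τ A₁ B₁ → τ A₂ B₂ → τ A₃ B₃ →
       ¬ Covers A₁ A₂ A₃)

  τ₀ : OSepSet
  τ₀ A B = IsSeparation A B × order A B ≤ 3 × ∣ A ∣ < ∣ B ∣

-- A separation (A,B) of order ≤ 3 is either improper, one side being all of V(G) and the other
-- of size ≤ 3, or its separator S = A ∩ B disconnects G; then |S| = 3, S is independent, and one
-- side is a star {w} ∪ S with N(w) ⊆ S while the other side also contains the connected rest of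
-- G, which has at least two vertices. So the sides differ in size, and every small side has at
-- most three vertices or is a star. As G has minimum degree 3, a vertex lying in only one of three
-- small sides must be the centre of a star, and counting shows that three small sides never cover
-- G. Conversely, a 4-tangle contains (X, V) whenever |X| ≤ 3, so it cannot point away from a small
-- side A: B, A - s and A - t would cover G for non-adjacent s, t ∈ A.
module Submission where

open import Data.Bool using (true)
import Data.Bool.Properties as Bool
open import Data.Empty using (⊥; ⊥-elim)
open import Data.Fin using (Fin; zero; suc)
open import Data.Fin.Properties using (_≟_)
open import Data.Fin.Subset
  using (Subset; inside; outside; _∈_; _∉_; _⊆_; _∩_; _∪_; ∁; ⁅_⁆; _-_; ⊤; ∣_∣; Nonempty)
open import Data.Fin.Subset.Properties
  using ( _∈?_; nonempty?; Empty-unique; ∣⊥∣≡0; ∣⊤∣≡n; ∣p∩q∣≤∣p∣; ∣⁅x⁆∣≡1; ∈⊤; ∩-comm; ⊆-antisym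
        ; p─⊥≡p; p─q⊆p; ∣p─q∣≤∣p∣; p⊆q⇒∣p∣≤∣q∣; x∈p⇒∣p-x∣<∣p∣; x∈p∧x≢y⇒x∈p-y
        ; x∈p∩q⁺; x∈p∩q⁻; x∈p∪q⁺; x∈p∪q⁻; x∉p⇒x∈∁p; x∈∁p⇒x∉p; x∉∁p⇒x∈p
        ; x∈⁅x⁆; x≢y⇒x∉⁅y⁆ )
open import Data.Nat using (ℕ; zero; suc; _+_; _≤_; _<_; _≤?_; z≤n; s≤s)
open import Data.Nat.Properties
  using ( +-suc; +-monoˡ-≤; +-monoʳ-≤; +-mono-≤; +-cancelˡ-≤; ≤-pred; ≤-reflexive; ≤-trans; <⇒≤
        ; <-≤-trans; ≤-<-trans; <-irrefl; <-asym; n≤1+n; m≤m+n; ≰⇒>; m≤n⇒m<n∨m≡n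
        ; module ≤-Reasoning )
open import Data.Product using (Σ; ∃; ∃₂; _×_; _,_; proj₁; proj₂)
open import Data.Sum using (_⊎_; inj₁; inj₂)
open import Data.Vec using (_∷_; []; here; there)
open import Function using (_∘_)
open import Function.Bundles using (_⇔_; mk⇔)
open import Relation.Nullary using (¬_; Dec; yes; no)
open import Relation.Binary.PropositionalEquality
  using (_≡_; _≢_; refl; sym; trans; cong; cong₂; subst)

open import Defs

private variable n : ℕ

∣p∣≤suc∣p-x∣ : (p : Subset n) (x : Fin n) → ∣ p ∣ ≤ suc ∣ p - x ∣
∣p∣≤suc∣p-x∣ (inside  ∷ p) zero    = s≤s (≤-reflexive (cong ∣_∣ (sym (p─⊥≡p p))))
∣p∣≤suc∣p-x∣ (outside ∷ p) zero    = ≤-trans (≤-reflexive (cong ∣_∣ (sym (p─⊥≡p p)))) (n≤1+n _)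
∣p∣≤suc∣p-x∣ (inside  ∷ p) (suc x) = s≤s (∣p∣≤suc∣p-x∣ p x)
∣p∣≤suc∣p-x∣ (outside ∷ p) (suc x) = ∣p∣≤suc∣p-x∣ p x

x∉p-x : (p : Subset n) (x : Fin n) → x ∉ p - x
x∉p-x (s ∷ p) zero    ()
x∉p-x (s ∷ p) (suc x) (there x∈p-x) = x∉p-x p x x∈p-x

∣p∪q∣+∣p∩q∣≡∣p∣+∣q∣ : (p q : Subset n) → ∣ p ∪ q ∣ + ∣ p ∩ q ∣ ≡ ∣ p ∣ + ∣ q ∣
∣p∪q∣+∣p∩q∣≡∣p∣+∣q∣ []            []            = refl
∣p∪q∣+∣p∩q∣≡∣p∣+∣q∣ (inside  ∷ p) (inside  ∷ q) =
  cong suc (trans (+-suc ∣ p ∪ q ∣ ∣ p ∩ q ∣)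
    (trans (cong suc (∣p∪q∣+∣p∩q∣≡∣p∣+∣q∣ p q)) (sym (+-suc ∣ p ∣ ∣ q ∣))))
∣p∪q∣+∣p∩q∣≡∣p∣+∣q∣ (inside  ∷ p) (outside ∷ q) = cong suc (∣p∪q∣+∣p∩q∣≡∣p∣+∣q∣ p q)
∣p∪q∣+∣p∩q∣≡∣p∣+∣q∣ (outside ∷ p) (inside  ∷ q) =
  trans (cong suc (∣p∪q∣+∣p∩q∣≡∣p∣+∣q∣ p q)) (sym (+-suc ∣ p ∣ ∣ q ∣))
∣p∪q∣+∣p∩q∣≡∣p∣+∣q∣ (outside ∷ p) (outside ∷ q) = ∣p∪q∣+∣p∩q∣≡∣p∣+∣q∣ p q

∣p∪q∣≤∣p∣+∣q∣ : (p q : Subset n) → ∣ p ∪ q ∣ ≤ ∣ p ∣ + ∣ q ∣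
∣p∪q∣≤∣p∣+∣q∣ p q = ≤-trans (m≤m+n _ _) (≤-reflexive (∣p∪q∣+∣p∩q∣≡∣p∣+∣q∣ p q))

covering⇒n≤∣p∣+∣q∣ : (p q : Subset n) → (∀ x → x ∈ p ⊎ x ∈ q) → n ≤ ∣ p ∣ + ∣ q ∣
covering⇒n≤∣p∣+∣q∣ {n} p q cover = begin
  n             ≡⟨ sym (∣⊤∣≡n n) ⟩
  ∣ ⊤ {n} ∣     ≤⟨ p⊆q⇒∣p∣≤∣q∣ {p = ⊤} (λ {x} _ → x∈p∪q⁺ (cover x)) ⟩
  ∣ p ∪ q ∣     ≤⟨ ∣p∪q∣≤∣p∣+∣q∣ p q ⟩
  ∣ p ∣ + ∣ q ∣ ∎
  where open ≤-Reasoning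

∣p∣+∣∁p∣≡n : (p : Subset n) → ∣ p ∣ + ∣ ∁ p ∣ ≡ n
∣p∣+∣∁p∣≡n []            = refl
∣p∣+∣∁p∣≡n (inside  ∷ p) = cong suc (∣p∣+∣∁p∣≡n p)
∣p∣+∣∁p∣≡n (outside ∷ p) = trans (+-suc ∣ p ∣ ∣ ∁ p ∣) (cong suc (∣p∣+∣∁p∣≡n p))

∁-involutive : (p : Subset n) → ∁ (∁ p) ≡ p
∁-involutive []      = refl
∁-involutive (b ∷ p) = cong₂ _∷_ (Bool.not-involutive b) (∁-involutive p)

x∈⁅a⁆∪⁅b⁆ : {x a b : Fin n} → x ≡ a ⊎ x ≡ b → x ∈ ⁅ a ⁆ ∪ ⁅ b ⁆
x∈⁅a⁆∪⁅b⁆ (inj₁ refl) = x∈p∪q⁺ (inj₁ (x∈⁅x⁆ _))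
x∈⁅a⁆∪⁅b⁆ (inj₂ refl) = x∈p∪q⁺ (inj₂ (x∈⁅x⁆ _))

∣⁅a⁆∪⁅b⁆∣≤2 : (a b : Fin n) → ∣ ⁅ a ⁆ ∪ ⁅ b ⁆ ∣ ≤ 2
∣⁅a⁆∪⁅b⁆∣≤2 a b = ≤-trans (∣p∪q∣≤∣p∣+∣q∣ ⁅ a ⁆ ⁅ b ⁆)
  (≤-reflexive (cong₂ _+_ (∣⁅x⁆∣≡1 a) (∣⁅x⁆∣≡1 b)))

0<∣p∣⇒Nonempty : ∀ {n} (p : Subset n) → 0 < ∣ p ∣ → Nonempty p
0<∣p∣⇒Nonempty {n} p 0<∣p∣ with nonempty? p
... | yes nonempty = nonempty
... | no empty     =
  ⊥-elim (<-irrefl refl (subst (0 <_) (trans (cong ∣_∣ (Empty-unique empty)) (∣⊥∣≡0 n)) 0<∣p∣))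

1<∣p∣⇒∃≢ : (p : Subset n) → 1 < ∣ p ∣ → ∀ x → ∃ λ y → y ∈ p × y ≢ x
1<∣p∣⇒∃≢ p 1<∣p∣ x with 0<∣p∣⇒Nonempty (p - x) (≤-pred (≤-trans 1<∣p∣ (∣p∣≤suc∣p-x∣ p x)))
... | y , y∈p-x = y , p─q⊆p p ⁅ x ⁆ y∈p-x , λ { refl → x∉p-x p x y∈p-x }

1<∣p∣⇒∃₂≢ : (p : Subset n) → 1 < ∣ p ∣ → ∃₂ λ x y → x ∈ p × y ∈ p × x ≢ y
1<∣p∣⇒∃₂≢ p 1<∣p∣ with 0<∣p∣⇒Nonempty p (<⇒≤ 1<∣p∣)
... | x , x∈p with 1<∣p∣⇒∃≢ p 1<∣p∣ x
...   | y , y∈p , y≢x = x , y , x∈p , y∈p , y≢x ∘ sym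

Empty∁⇒∈ : {p : Subset n} → ¬ Nonempty (∁ p) → ∀ x → x ∈ p
Empty∁⇒∈ ∁p-empty x = x∉∁p⇒x∈p λ x∈∁p → ∁p-empty (x , x∈∁p)

k+m≤a+x⇒m≤x : ∀ k {m a x} → k + m ≤ a + x → a ≤ k → m ≤ x
k+m≤a+x⇒m≤x k {m} {a} {x} le a≤k = +-cancelˡ-≤ k m x (≤-trans le (+-monoˡ-≤ x a≤k))

module _ (G : Graph n) where
  open Graph G

  Edge-sym : ∀ {u v} → Edge G u v → Edge G v u
  Edge-sym {u} {v} e = trans (symm v u) e

  Edge-irrefl : ∀ {v} → ¬ Edge G v v
  Edge-irrefl {v} e with trans (sym e) (irrefl v)
  ... | ()

  Edge⇒≢ : ∀ {u v} → Edge G u v → v ≢ u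
  Edge⇒≢ e refl = Edge-irrefl e

  Edge? : ∀ u v → Dec (Edge G u v)
  Edge? u v = adj u v Bool.≟ true

  Reach⇒neighbour : ∀ {U x y} → Reach G U x y → x ≢ y → ∃ λ w → w ∈ U × Edge G x w
  Reach⇒neighbour (here _) x≢x = ⊥-elim (x≢x refl)
  Reach⇒neighbour {x = x} (step {y} {z} walk z∈U e) x≢z with x ≟ y
  ... | yes refl = z , z∈U , e
  ... | no x≢y   = Reach⇒neighbour walk x≢y

  Independent∧Connected⇒≡ : ∀ {U x y} → Independent G U → Connected G U → x ∈ U → y ∈ U → x ≡ y
  Independent∧Connected⇒≡ {U} {x} {y} indep (_ , reach) x∈U y∈U with x ≟ y
  ... | yes x≡y = x≡y
  ... | no x≢y with Reach⇒neighbour (reach x y x∈U y∈U) x≢y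
  ...   | w , w∈U , e = ⊥-elim (indep x w x∈U w∈U e)

  IsSeparation-⊤ : ∀ {X} → IsSeparation G X ⊤
  IsSeparation-⊤ = (λ _ → x∈p∪q⁺ (inj₂ ∈⊤)) , λ _ _ _ u∉⊤ _ _ _ → u∉⊤ ∈⊤

  module _ {A B : Subset n} (sep : IsSeparation G A B) where

    IsSeparation-swap : IsSeparation G B A
    IsSeparation-swap = (λ v → x∈p∪q⁺ (swap (x∈p∪q⁻ A B (proj₁ sep v))))
                      , (λ u v u∈B u∉A v∈A v∉B e → proj₂ sep v u v∈A v∉B u∈B u∉A (Edge-sym e))
      where
      swap : ∀ {P Q : Set} → P ⊎ Q → Q ⊎ P
      swap (inj₁ p) = inj₂ p
      swap (inj₂ q) = inj₁ q

    x∉B⇒x∈A : ∀ {x} → x ∉ B → x ∈ A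
    x∉B⇒x∈A {x} x∉B with x∈p∪q⁻ A B (proj₁ sep x)
    ... | inj₁ x∈A = x∈A
    ... | inj₂ x∈B = ⊥-elim (x∉B x∈B)

    x∉A⇒x∈B : ∀ {x} → x ∉ A → x ∈ B
    x∉A⇒x∈B {x} x∉A with x∈p∪q⁻ A B (proj₁ sep x)
    ... | inj₁ x∈A = ⊥-elim (x∉A x∈A)
    ... | inj₂ x∈B = x∈B

    Edge-from-A∖B : ∀ {x y} → x ∉ B → Edge G x y → y ∈ A
    Edge-from-A∖B {x} {y} x∉B e with y ∈? A
    ... | yes y∈A = y∈A
    ... | no y∉A  = ⊥-elim (proj₂ sep x y (x∉B⇒x∈A x∉B) x∉B (x∉A⇒x∈B y∉A) y∉A e)

    Edge-within-side : ∀ {u v} → Edge G u v → (u ∈ A × v ∈ A) ⊎ (u ∈ B × v ∈ B)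
    Edge-within-side {u} {v} e with u ∈? B | v ∈? B
    ... | yes u∈B | yes v∈B = inj₂ (u∈B , v∈B)
    ... | no u∉B  | _       = inj₁ (x∉B⇒x∈A u∉B , Edge-from-A∖B u∉B e)
    ... | yes _   | no v∉B  = inj₁ (Edge-from-A∖B v∉B (Edge-sym e) , x∉B⇒x∈A v∉B)

    Reach-avoiding : ∀ {U x y} → (∀ {z} → z ∈ U → z ∈ A → z ∉ B) →
                     Reach G U x y → x ∉ B → y ∉ B
    Reach-avoiding avoid (here _)           x∉B = x∉B
    Reach-avoiding avoid (step walk z∈U e) x∉B =
      avoid z∈U (Edge-from-A∖B (Reach-avoiding avoid walk x∉B) e)

    proper-separation-disconnects : ∀ {a b} → a ∉ B → b ∉ A → ¬ Connected G (∁ (A ∩ B))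
    proper-separation-disconnects {a} {b} a∉B b∉A (_ , reach) =
      Reach-avoiding (λ z∈∁A∩B z∈A z∈B → x∈∁p⇒x∉p z∈∁A∩B (x∈p∩q⁺ (z∈A , z∈B)))
        (reach a b (∉A∩B (a∉B ∘ proj₂)) (∉A∩B (b∉A ∘ proj₁))) a∉B (x∉A⇒x∈B b∉A)
      where
      ∉A∩B : ∀ {x} → ¬ (x ∈ A × x ∈ B) → x ∈ ∁ (A ∩ B)
      ∉A∩B x∉ = x∉p⇒x∈∁p (x∉ ∘ x∈p∩q⁻ A B)

  module _ {A₁ A₂ A₃ : Subset n} where

    Covers-swap₁₂ : Covers G A₁ A₂ A₃ → Covers G A₂ A₁ A₃
    Covers-swap₁₂ (vertices , edges) = (λ v → swap (vertices v)) , (λ u v e → swap (edges u v e))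
      where
      swap : ∀ {P Q R : Set} → P ⊎ Q ⊎ R → Q ⊎ P ⊎ R
      swap (inj₁ p)        = inj₂ (inj₁ p)
      swap (inj₂ (inj₁ q)) = inj₁ q
      swap (inj₂ (inj₂ r)) = inj₂ (inj₂ r)

    Covers-swap₂₃ : Covers G A₁ A₂ A₃ → Covers G A₁ A₃ A₂
    Covers-swap₂₃ (vertices , edges) = (λ v → swap (vertices v)) , (λ u v e → swap (edges u v e))
      where
      swap : ∀ {P Q R : Set} → P ⊎ Q ⊎ R → P ⊎ R ⊎ Q
      swap (inj₁ p)        = inj₁ p
      swap (inj₂ (inj₁ q)) = inj₂ (inj₂ q)
      swap (inj₂ (inj₂ r)) = inj₂ (inj₁ r)

    Covers-only-by₁ : Covers G A₁ A₂ A₃ → ∀ {x} → x ∉ A₂ → x ∉ A₃ →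
                      x ∈ A₁ × (∀ {z} → Edge G x z → z ∈ A₁)
    Covers-only-by₁ (vertices , edges) {x} x∉A₂ x∉A₃ = in₁ (vertices x) , λ {z} e → nbr (edges x z e)
      where
      in₁ : x ∈ A₁ ⊎ x ∈ A₂ ⊎ x ∈ A₃ → x ∈ A₁
      in₁ (inj₁ x∈A₁)        = x∈A₁
      in₁ (inj₂ (inj₁ x∈A₂)) = ⊥-elim (x∉A₂ x∈A₂)
      in₁ (inj₂ (inj₂ x∈A₃)) = ⊥-elim (x∉A₃ x∈A₃)
      nbr : ∀ {z} → (x ∈ A₁ × z ∈ A₁) ⊎ (x ∈ A₂ × z ∈ A₂) ⊎ (x ∈ A₃ × z ∈ A₃) → z ∈ A₁
      nbr (inj₁ (_ , z∈A₁))        = z∈A₁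
      nbr (inj₂ (inj₁ (x∈A₂ , _))) = ⊥-elim (x∉A₂ x∈A₂)
      nbr (inj₂ (inj₂ (x∈A₃ , _))) = ⊥-elim (x∉A₃ x∈A₃)

  record Star (A : Subset n) : Set where
    field
      centre             : Fin n
      leaves-size        : ∣ A - centre ∣ ≡ 3
      leaves-independent : Independent G (A - centre)
      centre-adjacent⊆   : ∀ {z} → Edge G centre z → z ∈ A
      outside-connected  : Connected G (∁ A)

    distinct-leaves : ∃₂ λ s t → s ∈ A - centre × t ∈ A - centre × s ≢ t
    distinct-leaves = 1<∣p∣⇒∃₂≢ (A - centre) (subst (1 <_) (sym leaves-size) (s≤s (s≤s z≤n)))

    size≤4 : ∣ A ∣ ≤ 4
    size≤4 = ≤-trans (∣p∣≤suc∣p-x∣ A centre) (s≤s (≤-reflexive leaves-size))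

    centre-adjacent⊆leaves : ∀ {z} → Edge G centre z → z ∈ A - centre
    centre-adjacent⊆leaves e = x∈p∧x≢y⇒x∈p-y (centre-adjacent⊆ e) (Edge⇒≢ e)

    Edge⇒centre : ∀ {x z} → x ∈ A → z ∈ A → Edge G x z → x ≢ centre → z ≡ centre
    Edge⇒centre x∈A z∈A e x≢c with _ ≟ centre
    ... | yes z≡c = z≡c
    ... | no z≢c  = ⊥-elim (leaves-independent _ _ (x∈p∧x≢y⇒x∈p-y x∈A x≢c) (x∈p∧x≢y⇒x∈p-y z∈A z≢c) e)

module _ {G : Graph n} (I4C : Internally4Connected G) where

  private
    4<n : 4 < n
    4<n = proj₁ (proj₂ I4C)

    connected-without : ∀ X → ∣ X ∣ < 3 → Connected G (∁ X)
    connected-without = proj₂ (proj₁ I4C)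

  neighbourhood-large : ∀ {x X} → x ∉ X → ∣ X ∣ ≤ 2 → ¬ (∀ {z} → Edge G x z → z ∈ X)
  neighbourhood-large {x} {X} x∉X ∣X∣≤2 N⊆X
    with 1<∣p∣⇒∃≢ (∁ X) (k+m≤a+x⇒m≤x 2 (≤-trans (<⇒≤ 4<n) (≤-reflexive (sym (∣p∣+∣∁p∣≡n X)))) ∣X∣≤2) x
  ... | z , z∈∁X , z≢x
    with Reach⇒neighbour G (proj₂ (connected-without X (s≤s ∣X∣≤2)) x z (x∉p⇒x∈∁p x∉X) z∈∁X) (z≢x ∘ sym)
  ...   | w , w∈∁X , e = x∈∁p⇒x∉p w∈∁X (N⊆X e)

  degree≥3 : ∀ {x} a b → ¬ (∀ {z} → Edge G x z → z ≡ a ⊎ z ≡ b)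
  degree≥3 {x} a b N⊆ab = neighbourhood-large (x∉p-x pair x)
    (≤-trans (∣p─q∣≤∣p∣ pair ⁅ x ⁆) (∣⁅a⁆∪⁅b⁆∣≤2 a b))
    (λ e → x∈p∧x≢y⇒x∈p-y (x∈⁅a⁆∪⁅b⁆ (N⊆ab e)) (Edge⇒≢ G e))
    where pair = ⁅ a ⁆ ∪ ⁅ b ⁆

  closed-neighbourhood-large : ∀ {x X} → x ∈ X → ∣ X ∣ ≤ 3 → ¬ (∀ {z} → Edge G x z → z ∈ X)
  closed-neighbourhood-large {x} {X} x∈X ∣X∣≤3 N⊆X = neighbourhood-large (x∉p-x X x)
    (≤-pred (≤-trans (x∈p⇒∣p-x∣<∣p∣ x∈X) ∣X∣≤3))
    (λ e → x∈p∧x≢y⇒x∈p-y (N⊆X e) (Edge⇒≢ G e))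

  module _ {A : Subset n} (star : Star G A) where
    open Star star

    -- If n ≤ 5, deleting the at most two non-leaves leaves G[leaves] connected.
    Star⇒5<n : 5 < n
    Star⇒5<n with n ≤? 5
    ... | no n≰5 = ≰⇒> n≰5
    ... | yes n≤5 with distinct-leaves
    ...   | s , t , s∈ , t∈ , s≢t = ⊥-elim (s≢t (Independent∧Connected⇒≡ G leaves-independent
            (subst (Connected G) (∁-involutive (A - centre)) (connected-without _ ∣∁leaves∣<3)) s∈ t∈))
      where
      ∣∁leaves∣<3 : ∣ ∁ (A - centre) ∣ < 3
      ∣∁leaves∣<3 = s≤s (+-cancelˡ-≤ 3 _ 2 (≤-trans
        (≤-reflexive (trans (cong (_+ ∣ ∁ (A - centre) ∣) (sym leaves-size)) (∣p∣+∣∁p∣≡n (A - centre))))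
        n≤5))

    Star⇒1<∣∁A∣ : 1 < ∣ ∁ A ∣
    Star⇒1<∣∁A∣ = k+m≤a+x⇒m≤x 4 (≤-trans Star⇒5<n (≤-reflexive (sym (∣p∣+∣∁p∣≡n A)))) size≤4

  SmallSide : Subset n → Subset n → Set
  SmallSide A B = (∀ x → x ∈ B) ⊎ Σ (Star G A) λ star → ∀ {x} → x ∉ B → x ≡ Star.centre star

  SmallSide-of-star : ∀ {A B S w b} → IsSeparation G A B → S ≡ A ∩ B →
    Independent G S → ∣ S ∣ ≡ 3 → w ∈ A → w ∉ B →
    (∀ u → u ∈ ∁ S → ¬ Edge G w u) → Connected G (∁ S ∩ ∁ ⁅ w ⁆) → b ∉ A →
    SmallSide A B
  SmallSide-of-star {A} {B} {S} {w} {b} sep S≡A∩B indep ∣S∣≡3 w∈A w∉B isolated rest-connected b∉A =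
    inj₂ (star , ∉B⇒≡w)
    where
    S⇒A×B : ∀ {x} → x ∈ S → x ∈ A × x ∈ B
    S⇒A×B x∈S = x∈p∩q⁻ A B (subst (_ ∈_) S≡A∩B x∈S)

    A×B⇒S : ∀ {x} → x ∈ A → x ∈ B → x ∈ S
    A×B⇒S x∈A x∈B = subst (_ ∈_) (sym S≡A∩B) (x∈p∩q⁺ (x∈A , x∈B))

    rest : Subset n
    rest = ∁ S ∩ ∁ ⁅ w ⁆

    rest⁺ : ∀ {x} → x ∉ S → x ≢ w → x ∈ rest
    rest⁺ x∉S x≢w = x∈p∩q⁺ (x∉p⇒x∈∁p x∉S , x∉p⇒x∈∁p (x≢y⇒x∉⁅y⁆ x≢w))

    rest⁻ : ∀ {x} → x ∈ rest → x ∉ S × x ≢ w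
    rest⁻ x∈rest with x∈p∩q⁻ (∁ S) (∁ ⁅ w ⁆) x∈rest
    ... | x∈∁S , x∈∁w = x∈∁p⇒x∉p x∈∁S , λ { refl → x∈∁p⇒x∉p x∈∁w (x∈⁅x⁆ w) }

    avoid : ∀ {z} → z ∈ rest → z ∈ A → z ∉ B
    avoid z∈rest z∈A z∈B = proj₁ (rest⁻ z∈rest) (A×B⇒S z∈A z∈B)

    b∈rest : b ∈ rest
    b∈rest = rest⁺ (b∉A ∘ proj₁ ∘ S⇒A×B) λ { refl → b∉A w∈A }

    -- A ∖ B = {w}: any other vertex of A ∖ B would reach b ∉ A inside G - S - w.
    A-w≡S : A - w ≡ S
    A-w≡S = ⊆-antisym A-w⊆S S⊆A-w
      where
      A-w⊆S : A - w ⊆ S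
      A-w⊆S {x} x∈A-w with x ∈? B
      ... | yes x∈B = A×B⇒S (p─q⊆p A ⁅ w ⁆ x∈A-w) x∈B
      ... | no x∉B  = ⊥-elim (Reach-avoiding G sep avoid
            (proj₂ rest-connected x b (rest⁺ (x∉B ∘ proj₂ ∘ S⇒A×B) λ { refl → x∉p-x A w x∈A-w }) b∈rest)
            x∉B (x∉A⇒x∈B G sep b∉A))
      S⊆A-w : S ⊆ A - w
      S⊆A-w x∈S = x∈p∧x≢y⇒x∈p-y (proj₁ (S⇒A×B x∈S)) λ { refl → w∉B (proj₂ (S⇒A×B x∈S)) }

    rest≡∁A : rest ≡ ∁ A
    rest≡∁A = ⊆-antisym
      (λ x∈rest → x∉p⇒x∈∁p λ x∈A →
        proj₁ (rest⁻ x∈rest) (subst (_ ∈_) A-w≡S (x∈p∧x≢y⇒x∈p-y x∈A (proj₂ (rest⁻ x∈rest)))))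
      (λ x∈∁A → rest⁺ (x∈∁p⇒x∉p x∈∁A ∘ proj₁ ∘ S⇒A×B) λ { refl → x∈∁p⇒x∉p x∈∁A w∈A })

    centre-adjacent⊆ : ∀ {z} → Edge G w z → z ∈ A
    centre-adjacent⊆ {z} e with z ∈? S
    ... | yes z∈S = proj₁ (S⇒A×B z∈S)
    ... | no z∉S  = ⊥-elim (isolated z (x∉p⇒x∈∁p z∉S) e)

    star : Star G A
    star = record
      { centre             = w
      ; leaves-size        = trans (cong ∣_∣ A-w≡S) ∣S∣≡3
      ; leaves-independent = subst (Independent G) (sym A-w≡S) indep
      ; centre-adjacent⊆   = centre-adjacent⊆
      ; outside-connected  = subst (Connected G) rest≡∁A rest-connected
      }

    ∉B⇒≡w : ∀ {x} → x ∉ B → x ≡ w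
    ∉B⇒≡w {x} x∉B with x ≟ w
    ... | yes x≡w = x≡w
    ... | no x≢w  = ⊥-elim (x∉B (proj₂ (S⇒A×B (subst (_ ∈_) A-w≡S x∈A-w))))
      where x∈A-w = x∈p∧x≢y⇒x∈p-y (x∉B⇒x∈A G sep x∉B) x≢w

  disconnecting⇒∣X∣≡3 : ∀ {X} → ∣ X ∣ ≤ 3 → ¬ Connected G (∁ X) → ∣ X ∣ ≡ 3
  disconnecting⇒∣X∣≡3 {X} ∣X∣≤3 disconnected with m≤n⇒m<n∨m≡n ∣X∣≤3
  ... | inj₁ ∣X∣<3 = ⊥-elim (disconnected (connected-without X ∣X∣<3))
  ... | inj₂ ∣X∣≡3 = ∣X∣≡3

  SmallSide-of-proper : ∀ {A B a b} → IsSeparation G A B → order G A B ≤ 3 → a ∉ B → b ∉ A →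
                        SmallSide A B ⊎ SmallSide B A
  SmallSide-of-proper {A} {B} {a} {b} sep order≤3 a∉B b∉A =
    orient (proj₂ (proj₂ I4C) (A ∩ B) ∣A∩B∣≡3 disconnected)
    where
    disconnected : ¬ Connected G (∁ (A ∩ B))
    disconnected = proper-separation-disconnects G sep a∉B b∉A
    ∣A∩B∣≡3 : ∣ A ∩ B ∣ ≡ 3
    ∣A∩B∣≡3 = disconnecting⇒∣X∣≡3 order≤3 disconnected
    orient : Independent G (A ∩ B) × TwoCompsOneTrivial G (Minus G (A ∩ B)) →
             SmallSide A B ⊎ SmallSide B A
    orient (indep , w , w∈∁S , isolated , rest-connected) with x∈p∪q⁻ A B (proj₁ sep w)
    ... | inj₁ w∈A = inj₁ (SmallSide-of-star sep refl indep ∣A∩B∣≡3 w∈A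
                     (λ w∈B → x∈∁p⇒x∉p w∈∁S (x∈p∩q⁺ (w∈A , w∈B))) isolated rest-connected b∉A)
    ... | inj₂ w∈B = inj₂ (SmallSide-of-star (IsSeparation-swap G sep) (∩-comm A B) indep ∣A∩B∣≡3 w∈B
                     (λ w∈A → x∈∁p⇒x∉p w∈∁S (x∈p∩q⁺ (w∈A , w∈B))) isolated rest-connected a∉B)

  classify : ∀ {A B} → IsSeparation G A B → order G A B ≤ 3 → SmallSide A B ⊎ SmallSide B A
  classify {A} {B} sep order≤3 with nonempty? (∁ B) | nonempty? (∁ A)
  ... | no ∁B-empty    | _              = inj₁ (inj₁ (Empty∁⇒∈ ∁B-empty))
  ... | yes _          | no ∁A-empty    = inj₂ (inj₁ (Empty∁⇒∈ ∁A-empty))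
  ... | yes (a , a∈∁B) | yes (b , b∈∁A) =
    SmallSide-of-proper sep order≤3 (x∈∁p⇒x∉p a∈∁B) (x∈∁p⇒x∉p b∈∁A)

  Small : Subset n → Set
  Small A = ∣ A ∣ ≤ 3 ⊎ Star G A

  Small⇒∣A∣≤4 : ∀ {A} → Small A → ∣ A ∣ ≤ 4
  Small⇒∣A∣≤4 (inj₁ ∣A∣≤3) = ≤-trans ∣A∣≤3 (n≤1+n 3)
  Small⇒∣A∣≤4 (inj₂ star)  = Star.size≤4 star

  SmallSide⇒Small : ∀ {A B} → SmallSide A B → order G A B ≤ 3 → Small A
  SmallSide⇒Small {A} {B} (inj₁ B-total) order≤3 =
    inj₁ (≤-trans (p⊆q⇒∣p∣≤∣q∣ {p = A} λ {x} x∈A → x∈p∩q⁺ (x∈A , B-total x)) order≤3)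
  SmallSide⇒Small (inj₂ (star , _)) _ = inj₂ star

  SmallSide⇒4<∣B∣ : ∀ {A B} → SmallSide A B → 4 < ∣ B ∣
  SmallSide⇒4<∣B∣ (inj₁ B-total) =
    <-≤-trans 4<n (≤-trans (≤-reflexive (sym (∣⊤∣≡n n))) (p⊆q⇒∣p∣≤∣q∣ {p = ⊤} λ {x} _ → B-total x))
  SmallSide⇒4<∣B∣ {A} {B} (inj₂ (star , ∉B⇒centre)) =
    k+m≤a+x⇒m≤x 1 (≤-trans (Star⇒5<n star) (covering⇒n≤∣p∣+∣q∣ ⁅ centre ⁆ B centre-or-B))
      (≤-reflexive (∣⁅x⁆∣≡1 centre))
    where
    open Star star
    centre-or-B : ∀ x → x ∈ ⁅ centre ⁆ ⊎ x ∈ B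
    centre-or-B x with x ∈? B
    ... | yes x∈B = inj₂ x∈B
    ... | no x∉B  = inj₁ (subst (_∈ ⁅ centre ⁆) (sym (∉B⇒centre x∉B)) (x∈⁅x⁆ centre))

  order-sym : ∀ {A B} → order G A B ≤ 3 → order G B A ≤ 3
  order-sym {A} {B} = subst (λ X → ∣ X ∣ ≤ 3) (∩-comm A B)

  SmallSide⇒∣A∣<∣B∣ : ∀ {A B} → SmallSide A B → order G A B ≤ 3 → ∣ A ∣ < ∣ B ∣
  SmallSide⇒∣A∣<∣B∣ small order≤3 =
    ≤-<-trans (Small⇒∣A∣≤4 (SmallSide⇒Small small order≤3)) (SmallSide⇒4<∣B∣ small)

  sides-differ : ∀ {A B} → IsSeparation G A B → order G A B ≤ 3 → ∣ A ∣ < ∣ B ∣ ⊎ ∣ B ∣ < ∣ A ∣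
  sides-differ {A} {B} sep order≤3 with classify sep order≤3
  ... | inj₁ small = inj₁ (SmallSide⇒∣A∣<∣B∣ small order≤3)
  ... | inj₂ small = inj₂ (SmallSide⇒∣A∣<∣B∣ small (order-sym {A} {B} order≤3))

  τ₀⇒SmallSide : ∀ {A B} → τ₀ G A B → SmallSide A B
  τ₀⇒SmallSide {A} {B} (sep , order≤3 , ∣A∣<∣B∣) with classify sep order≤3
  ... | inj₁ small = small
  ... | inj₂ small = ⊥-elim (<-asym ∣A∣<∣B∣ (SmallSide⇒∣A∣<∣B∣ small (order-sym {A} {B} order≤3)))

  small-has-no-private-vertex : ∀ {A₁ A₂ A₃} → Covers G A₁ A₂ A₃ → ∣ A₁ ∣ ≤ 3 →
                                ∀ {x} → x ∉ A₂ → x ∉ A₃ → ⊥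
  small-has-no-private-vertex cover ∣A₁∣≤3 x∉A₂ x∉A₃ =
    let x∈A₁ , N⊆A₁ = Covers-only-by₁ G cover x∉A₂ x∉A₃
    in closed-neighbourhood-large x∈A₁ ∣A₁∣≤3 N⊆A₁

  private-vertex-of-star : ∀ {A₁ A₂ A₃} → Covers G A₁ A₂ A₃ → (star : Star G A₁) →
                           ∀ {x} → x ∉ A₂ → x ∉ A₃ → x ≡ Star.centre star
  private-vertex-of-star cover star {x} x∉A₂ x∉A₃ with x ≟ Star.centre star
  ... | yes x≡c = x≡c
  ... | no x≢c  = ⊥-elim (degree≥3 c c λ e → inj₁ (Star.Edge⇒centre star x∈A₁ (N⊆A₁ e) e x≢c))
    where
    c = Star.centre star
    x∈A₁ = proj₁ (Covers-only-by₁ G cover x∉A₂ x∉A₃)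
    N⊆A₁ = proj₂ (Covers-only-by₁ G cover x∉A₂ x∉A₃)

  outside-in-smalls : ∀ {A₁ A₂ A₃} → Covers G A₁ A₂ A₃ → ∣ A₂ ∣ ≤ 3 → ∣ A₃ ∣ ≤ 3 →
                      ∀ {x} → x ∉ A₁ → x ∈ A₂ ∩ A₃
  outside-in-smalls {A₁} {A₂} {A₃} cover ∣A₂∣≤3 ∣A₃∣≤3 {x} x∉A₁ with x ∈? A₂ | x ∈? A₃
  ... | yes x∈A₂ | yes x∈A₃ = x∈p∩q⁺ (x∈A₂ , x∈A₃)
  ... | no x∉A₂  | _        =
    ⊥-elim (small-has-no-private-vertex (Covers-swap₁₂ G (Covers-swap₂₃ G cover)) ∣A₃∣≤3 x∉A₁ x∉A₂)
  ... | yes _    | no x∉A₃  =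
    ⊥-elim (small-has-no-private-vertex (Covers-swap₁₂ G cover) ∣A₂∣≤3 x∉A₁ x∉A₃)

  no-cover-by-two-smalls : ∀ {A₁ A₂ A₃} → Covers G A₁ A₂ A₃ → ∣ A₂ ∣ ≤ 3 → ∣ A₃ ∣ ≤ 3 →
                           1 < ∣ ∁ A₁ ∣ → 4 < ∣ A₂ ∪ A₃ ∣ → ⊥
  no-cover-by-two-smalls {A₁} {A₂} {A₃} cover ∣A₂∣≤3 ∣A₃∣≤3 1<∣∁A₁∣ 4<∣A₂∪A₃∣ =
    <-irrefl refl (begin-strict
      6                          <⟨ +-mono-≤ 4<∣A₂∪A₃∣ 1<∣∁A₁∣ ⟩
      ∣ A₂ ∪ A₃ ∣ + ∣ ∁ A₁ ∣     ≤⟨ +-monoʳ-≤ ∣ A₂ ∪ A₃ ∣ (p⊆q⇒∣p∣≤∣q∣ (∁A₁⊆A₂∩A₃ ∘ x∈∁p⇒x∉p)) ⟩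
      ∣ A₂ ∪ A₃ ∣ + ∣ A₂ ∩ A₃ ∣  ≡⟨ ∣p∪q∣+∣p∩q∣≡∣p∣+∣q∣ A₂ A₃ ⟩
      ∣ A₂ ∣ + ∣ A₃ ∣            ≤⟨ +-mono-≤ ∣A₂∣≤3 ∣A₃∣≤3 ⟩
      6                          ∎)
    where
    open ≤-Reasoning
    ∁A₁⊆A₂∩A₃ = outside-in-smalls cover ∣A₂∣≤3 ∣A₃∣≤3

  no-cover-ttt : ∀ {A₁ A₂ A₃} → Covers G A₁ A₂ A₃ → ∣ A₁ ∣ ≤ 3 → ∣ A₂ ∣ ≤ 3 → ∣ A₃ ∣ ≤ 3 → ⊥
  no-cover-ttt {A₁} {A₂} {A₃} cover ∣A₁∣≤3 ∣A₂∣≤3 ∣A₃∣≤3 = no-cover-by-two-smalls cover ∣A₂∣≤3 ∣A₃∣≤3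
    (k+m≤a+x⇒m≤x 3 (≤-trans 4<n (≤-reflexive (sym (∣p∣+∣∁p∣≡n A₁)))) ∣A₁∣≤3)
    (<-≤-trans 4<n (≤-trans (≤-reflexive (sym (∣⊤∣≡n n))) (p⊆q⇒∣p∣≤∣q∣ {p = ⊤} λ {x} _ → in₂∪₃ x)))
    where
    in₂∪₃ : ∀ x → x ∈ A₂ ∪ A₃
    in₂∪₃ x with x ∈? A₂ | x ∈? A₃
    ... | yes x∈A₂ | _        = x∈p∪q⁺ (inj₁ x∈A₂)
    ... | no _     | yes x∈A₃ = x∈p∪q⁺ (inj₂ x∈A₃)
    ... | no x∉A₂  | no x∉A₃  = ⊥-elim (small-has-no-private-vertex cover ∣A₁∣≤3 x∉A₂ x∉A₃)

  no-cover-stt : ∀ {A₁ A₂ A₃} → Covers G A₁ A₂ A₃ → Star G A₁ → ∣ A₂ ∣ ≤ 3 → ∣ A₃ ∣ ≤ 3 → ⊥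
  no-cover-stt {A₁} {A₂} {A₃} cover star ∣A₂∣≤3 ∣A₃∣≤3 = no-cover-by-two-smalls cover ∣A₂∣≤3 ∣A₃∣≤3
    (Star⇒1<∣∁A∣ star)
    (k+m≤a+x⇒m≤x 1 (≤-trans (Star⇒5<n star) (covering⇒n≤∣p∣+∣q∣ ⁅ centre ⁆ (A₂ ∪ A₃) centre-or-in₂∪₃))
      (≤-reflexive (∣⁅x⁆∣≡1 centre)))
    where
    open Star star
    centre-or-in₂∪₃ : ∀ x → x ∈ ⁅ centre ⁆ ⊎ x ∈ A₂ ∪ A₃
    centre-or-in₂∪₃ x with x ∈? A₂ | x ∈? A₃
    ... | yes x∈A₂ | _        = inj₂ (x∈p∪q⁺ (inj₁ x∈A₂))
    ... | no _     | yes x∈A₃ = inj₂ (x∈p∪q⁺ (inj₂ x∈A₃))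
    ... | no x∉A₂  | no x∉A₃  =
      inj₁ (subst (_∈ ⁅ centre ⁆) (sym (private-vertex-of-star cover star x∉A₂ x∉A₃)) (x∈⁅x⁆ centre))

  two-stars-neighbour : ∀ {A₁ A₂ A₃} → Covers G A₁ A₂ A₃ → (s₁ : Star G A₁) (s₂ : Star G A₂) →
    ∀ {x z} → x ≢ Star.centre s₁ → x ≢ Star.centre s₂ → Edge G x z →
    z ≡ Star.centre s₁ ⊎ z ≡ Star.centre s₂ ⊎ (x ∈ A₃ × z ∈ A₃)
  two-stars-neighbour cover s₁ s₂ {x} {z} x≢c₁ x≢c₂ e with proj₂ cover x z e
  ... | inj₁ (x∈A₁ , z∈A₁)        = inj₁ (Star.Edge⇒centre s₁ x∈A₁ z∈A₁ e x≢c₁)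
  ... | inj₂ (inj₁ (x∈A₂ , z∈A₂)) = inj₂ (inj₁ (Star.Edge⇒centre s₂ x∈A₂ z∈A₂ e x≢c₂))
  ... | inj₂ (inj₂ in₃)           = inj₂ (inj₂ in₃)

  two-stars-cover : ∀ {A₁ A₂ A₃} → Covers G A₁ A₂ A₃ → (s₁ : Star G A₁) (s₂ : Star G A₂) →
    ∀ x → x ≡ Star.centre s₁ ⊎ x ≡ Star.centre s₂ ⊎ x ∈ A₃
  two-stars-cover {A₃ = A₃} cover s₁ s₂ x with x ≟ Star.centre s₁ | x ≟ Star.centre s₂ | x ∈? A₃
  ... | yes x≡c₁ | _        | _        = inj₁ x≡c₁
  ... | no _     | yes x≡c₂ | _        = inj₂ (inj₁ x≡c₂)
  ... | no _     | no _     | yes x∈A₃ = inj₂ (inj₂ x∈A₃)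
  ... | no x≢c₁  | no x≢c₂  | no x∉A₃  = ⊥-elim (degree≥3 (Star.centre s₁) (Star.centre s₂) nbr)
    where
    nbr : ∀ {z} → Edge G x z → z ≡ Star.centre s₁ ⊎ z ≡ Star.centre s₂
    nbr e with two-stars-neighbour cover s₁ s₂ x≢c₁ x≢c₂ e
    ... | inj₁ z≡c₁                = inj₁ z≡c₁
    ... | inj₂ (inj₁ z≡c₂)         = inj₂ z≡c₂
    ... | inj₂ (inj₂ (x∈A₃ , _))   = ⊥-elim (x∉A₃ x∈A₃)

  no-cover-sst : ∀ {A₁ A₂ A₃} → Covers G A₁ A₂ A₃ → Star G A₁ → Star G A₂ → ∣ A₃ ∣ ≤ 3 → ⊥
  no-cover-sst {A₃ = A₃} cover s₁ s₂ ∣A₃∣≤3 = <-irrefl refl (begin-strict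
    5                                  <⟨ Star⇒5<n s₁ ⟩
    n                                  ≤⟨ covering⇒n≤∣p∣+∣q∣ (⁅ c₁ ⁆ ∪ ⁅ c₂ ⁆) A₃ centres-or-in₃ ⟩
    ∣ ⁅ c₁ ⁆ ∪ ⁅ c₂ ⁆ ∣ + ∣ A₃ ∣        ≤⟨ +-mono-≤ (∣⁅a⁆∪⁅b⁆∣≤2 c₁ c₂) ∣A₃∣≤3 ⟩
    5                                  ∎)
    where
    open ≤-Reasoning
    c₁ = Star.centre s₁
    c₂ = Star.centre s₂
    centres-or-in₃ : ∀ x → x ∈ ⁅ c₁ ⁆ ∪ ⁅ c₂ ⁆ ⊎ x ∈ A₃
    centres-or-in₃ x with two-stars-cover cover s₁ s₂ x
    ... | inj₁ x≡c₁         = inj₁ (x∈⁅a⁆∪⁅b⁆ (inj₁ x≡c₁))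
    ... | inj₂ (inj₁ x≡c₂)  = inj₁ (x∈⁅a⁆∪⁅b⁆ (inj₂ x≡c₂))
    ... | inj₂ (inj₂ x∈A₃)  = inj₂ x∈A₃

  -- Every leaf s of the first star has all its neighbours among the three centres, so by
  -- degree ≥ 3 it is adjacent to c₂; then c₂ has the four neighbours A₁ - c₁ and c₃.
  no-cover-sss-adjacent : ∀ {A₁ A₂ A₃} → Covers G A₁ A₂ A₃ →
    (s₁ : Star G A₁) (s₂ : Star G A₂) (s₃ : Star G A₃) →
    Star.centre s₂ ∉ A₁ → Star.centre s₃ ∉ A₁ → Edge G (Star.centre s₂) (Star.centre s₃) → ⊥
  no-cover-sss-adjacent {A₁} {A₂} cover s₁ s₂ s₃ c₂∉A₁ c₃∉A₁ c₂~c₃ = <-irrefl refl (begin-strict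
    3                      ≡⟨ sym (Star.leaves-size s₁) ⟩
    ∣ A₁ - c₁ ∣            ≤⟨ p⊆q⇒∣p∣≤∣q∣ leaves₁⊆ ⟩
    ∣ A₂ - c₂ - c₃ ∣       <⟨ x∈p⇒∣p-x∣<∣p∣ (Star.centre-adjacent⊆leaves s₂ c₂~c₃) ⟩
    ∣ A₂ - c₂ ∣            ≡⟨ Star.leaves-size s₂ ⟩
    3                      ∎)
    where
    open ≤-Reasoning
    c₁ = Star.centre s₁
    c₂ = Star.centre s₂
    c₃ = Star.centre s₃

    ∉A₁⇒≢ : ∀ {s c} → s ∈ A₁ → c ∉ A₁ → s ≢ c
    ∉A₁⇒≢ s∈A₁ c∉A₁ refl = c∉A₁ s∈A₁

    leaf~c₂ : ∀ {s} → s ∈ A₁ - c₁ → Edge G s c₂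
    leaf~c₂ {s} s∈leaves with Edge? G s c₂
    ... | yes s~c₂ = s~c₂
    ... | no s≁c₂  = ⊥-elim (degree≥3 c₁ c₃ nbr)
      where
      s∈A₁ = p─q⊆p A₁ ⁅ c₁ ⁆ s∈leaves
      nbr : ∀ {z} → Edge G s z → z ≡ c₁ ⊎ z ≡ c₃
      nbr {z} e with two-stars-neighbour cover s₁ s₂
                       (λ { refl → x∉p-x A₁ c₁ s∈leaves }) (∉A₁⇒≢ s∈A₁ c₂∉A₁) e
      ... | inj₁ z≡c₁                = inj₁ z≡c₁
      ... | inj₂ (inj₁ refl)         = ⊥-elim (s≁c₂ e)
      ... | inj₂ (inj₂ (s∈A₃ , z∈A₃)) = inj₂ (Star.Edge⇒centre s₃ s∈A₃ z∈A₃ e (∉A₁⇒≢ s∈A₁ c₃∉A₁))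

    leaves₁⊆ : A₁ - c₁ ⊆ A₂ - c₂ - c₃
    leaves₁⊆ s∈leaves = x∈p∧x≢y⇒x∈p-y (Star.centre-adjacent⊆leaves s₂ (Edge-sym G (leaf~c₂ s∈leaves)))
                                      (∉A₁⇒≢ (p─q⊆p A₁ ⁅ c₁ ⁆ s∈leaves) c₃∉A₁)

  outside-two-stars : ∀ {A₁ A₂ A₃} → Covers G A₁ A₂ A₃ → (s₂ : Star G A₂) (s₃ : Star G A₃) →
    ∀ {x} → x ∉ A₁ → x ≡ Star.centre s₂ ⊎ x ≡ Star.centre s₃
  outside-two-stars cover s₂ s₃ {x} x∉A₁
    with two-stars-cover (Covers-swap₂₃ G (Covers-swap₁₂ G cover)) s₂ s₃ x
  ... | inj₁ x≡c₂        = inj₁ x≡c₂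
  ... | inj₂ (inj₁ x≡c₃) = inj₂ x≡c₃
  ... | inj₂ (inj₂ x∈A₁) = ⊥-elim (x∉A₁ x∈A₁)

  -- G - A₁ is connected with at least two vertices, so it contains an edge; its ends are c₂ and c₃.
  no-cover-sss : ∀ {A₁ A₂ A₃} → Covers G A₁ A₂ A₃ → Star G A₁ → Star G A₂ → Star G A₃ → ⊥
  no-cover-sss {A₁} cover s₁ s₂ s₃ with 1<∣p∣⇒∃₂≢ (∁ A₁) (Star⇒1<∣∁A∣ s₁)
  ... | y , y′ , y∈ , y′∈ , y≢y′
    with Reach⇒neighbour G (proj₂ (Star.outside-connected s₁) y y′ y∈ y′∈) y≢y′
  ...   | w , w∈ , y~w
    with outside-two-stars cover s₂ s₃ (x∈∁p⇒x∉p y∈) | outside-two-stars cover s₂ s₃ (x∈∁p⇒x∉p w∈)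
  ...     | inj₁ refl | inj₁ refl = Edge-irrefl G y~w
  ...     | inj₂ refl | inj₂ refl = Edge-irrefl G y~w
  ...     | inj₁ refl | inj₂ refl =
    no-cover-sss-adjacent cover s₁ s₂ s₃ (x∈∁p⇒x∉p y∈) (x∈∁p⇒x∉p w∈) y~w
  ...     | inj₂ refl | inj₁ refl =
    no-cover-sss-adjacent (Covers-swap₂₃ G cover) s₁ s₃ s₂ (x∈∁p⇒x∉p y∈) (x∈∁p⇒x∉p w∈) y~w

  no-cover : ∀ {A₁ A₂ A₃} → Small A₁ → Small A₂ → Small A₃ → ¬ Covers G A₁ A₂ A₃
  no-cover (inj₁ t₁) (inj₁ t₂) (inj₁ t₃) cover = no-cover-ttt cover t₁ t₂ t₃
  no-cover (inj₂ s₁) (inj₁ t₂) (inj₁ t₃) cover = no-cover-stt cover s₁ t₂ t₃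
  no-cover (inj₁ t₁) (inj₂ s₂) (inj₁ t₃) cover = no-cover-stt (Covers-swap₁₂ G cover) s₂ t₁ t₃
  no-cover (inj₁ t₁) (inj₁ t₂) (inj₂ s₃) cover =
    no-cover-stt (Covers-swap₁₂ G (Covers-swap₂₃ G cover)) s₃ t₁ t₂
  no-cover (inj₂ s₁) (inj₂ s₂) (inj₁ t₃) cover = no-cover-sst cover s₁ s₂ t₃
  no-cover (inj₂ s₁) (inj₁ t₂) (inj₂ s₃) cover = no-cover-sst (Covers-swap₂₃ G cover) s₁ s₃ t₂
  no-cover (inj₁ t₁) (inj₂ s₂) (inj₂ s₃) cover =
    no-cover-sst (Covers-swap₂₃ G (Covers-swap₁₂ G cover)) s₂ s₃ t₁
  no-cover (inj₂ s₁) (inj₂ s₂) (inj₂ s₃) cover = no-cover-sss cover s₁ s₂ s₃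

  τ₀⇒Small : ∀ {A B} → τ₀ G A B → Small A
  τ₀⇒Small t@(_ , order≤3 , _) = SmallSide⇒Small (τ₀⇒SmallSide t) order≤3

  τ₀-isTangle : IsTangle G 4 (τ₀ G)
  τ₀-isTangle =
      (λ _ _ (sep , order≤3 , _) → sep , s≤s order≤3)
    , (λ A B sep order<4 → orient sep (≤-pred order<4)
                         , λ (_ , _ , ∣A∣<∣B∣) (_ , _ , ∣B∣<∣A∣) → ⊥-elim (<-asym ∣A∣<∣B∣ ∣B∣<∣A∣))
    , (λ _ _ _ _ _ _ t₁ t₂ t₃ → no-cover (τ₀⇒Small t₁) (τ₀⇒Small t₂) (τ₀⇒Small t₃))
    where
    orient : ∀ {A B} → IsSeparation G A B → order G A B ≤ 3 → τ₀ G A B ⊎ τ₀ G B A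
    orient {A} {B} sep order≤3 with sides-differ sep order≤3
    ... | inj₁ ∣A∣<∣B∣ = inj₁ (sep , order≤3 , ∣A∣<∣B∣)
    ... | inj₂ ∣B∣<∣A∣ = inj₂ (IsSeparation-swap G sep , order-sym {A} {B} order≤3 , ∣B∣<∣A∣)

  module _ {τ : OSepSet G} (tangle : IsTangle G 4 τ) where
    private
      orientation = proj₁ (proj₂ tangle)
      no-three    = proj₂ (proj₂ tangle)

    ¬τ-from-whole : ∀ {A B} → (∀ x → x ∈ B) → ¬ τ B A
    ¬τ-from-whole B-total t = no-three _ _ _ _ _ _ t t t
      ((λ x → inj₁ (B-total x)) , λ u v _ → inj₁ (B-total u , B-total v))

    τ-small-to-⊤ : ∀ {X} → ∣ X ∣ ≤ 3 → τ X ⊤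
    τ-small-to-⊤ {X} ∣X∣≤3 with orientation X ⊤ (IsSeparation-⊤ G) (s≤s (≤-trans (∣p∩q∣≤∣p∣ X ⊤) ∣X∣≤3))
    ... | inj₁ t , _ = t
    ... | inj₂ t , _ = ⊥-elim (¬τ-from-whole (λ _ → ∈⊤) t)

    -- B, A - s and A - t cover G, as no edge of G[A] joins s and t.
    ¬τ-from-four : ∀ {A B s t} → IsSeparation G A B → ∣ A ∣ ≤ 4 → s ∈ A → t ∈ A → s ≢ t →
                   ¬ Edge G s t → ¬ τ B A
    ¬τ-from-four {A} {B} {s} {t} sep ∣A∣≤4 s∈A t∈A s≢t s≁t τBA = no-three _ _ _ _ _ _
      τBA (τ-small-to-⊤ (less s∈A)) (τ-small-to-⊤ (less t∈A)) (vertices , edges)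
      where
      less : ∀ {x} → x ∈ A → ∣ A - x ∣ ≤ 3
      less x∈A = ≤-pred (≤-trans (x∈p⇒∣p-x∣<∣p∣ x∈A) ∣A∣≤4)

      vertices : ∀ x → x ∈ B ⊎ x ∈ A - s ⊎ x ∈ A - t
      vertices x with x ∈? B | x ≟ s
      ... | yes x∈B | _        = inj₁ x∈B
      ... | no x∉B  | no x≢s   = inj₂ (inj₁ (x∈p∧x≢y⇒x∈p-y (x∉B⇒x∈A G sep x∉B) x≢s))
      ... | no x∉B  | yes refl = inj₂ (inj₂ (x∈p∧x≢y⇒x∈p-y (x∉B⇒x∈A G sep x∉B) s≢t))

      avoids-s-or-t : ∀ {u v} → Edge G u v → (u ≢ s × v ≢ s) ⊎ (u ≢ t × v ≢ t)
      avoids-s-or-t {u} {v} e with u ≟ s | v ≟ s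
      ... | no u≢s   | no v≢s   = inj₁ (u≢s , v≢s)
      ... | yes refl | _        = inj₂ (s≢t , λ { refl → s≁t e })
      ... | no _     | yes refl = inj₂ ((λ { refl → s≁t (Edge-sym G e) }) , s≢t)

      edges : ∀ u v → Edge G u v →
              (u ∈ B × v ∈ B) ⊎ (u ∈ A - s × v ∈ A - s) ⊎ (u ∈ A - t × v ∈ A - t)
      edges u v e with Edge-within-side G sep e | avoids-s-or-t e
      ... | inj₂ in-B              | _                  = inj₁ in-B
      ... | inj₁ (u∈A , v∈A) | inj₁ (u≢s , v≢s) =
        inj₂ (inj₁ (x∈p∧x≢y⇒x∈p-y u∈A u≢s , x∈p∧x≢y⇒x∈p-y v∈A v≢s))
      ... | inj₁ (u∈A , v∈A) | inj₂ (u≢t , v≢t) =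
        inj₂ (inj₂ (x∈p∧x≢y⇒x∈p-y u∈A u≢t , x∈p∧x≢y⇒x∈p-y v∈A v≢t))

    τ₀⇒¬τ-reversed : ∀ {A B} → τ₀ G A B → ¬ τ B A
    τ₀⇒¬τ-reversed t₀@(sep , _ , _) with τ₀⇒SmallSide t₀
    ... | inj₁ B-total = ¬τ-from-whole B-total
    ... | inj₂ (star , _) with Star.distinct-leaves star
    ...   | s , t , s∈ , t∈ , s≢t = ¬τ-from-four sep size≤4 (leaf∈ s∈) (leaf∈ t∈) s≢t
                                      (leaves-independent s t s∈ t∈)
      where
      open Star star
      leaf∈ = p─q⊆p _ ⁅ centre ⁆

    τ₀⊆τ : ∀ {A B} → τ₀ G A B → τ A B
    τ₀⊆τ {A} {B} t₀@(sep , order≤3 , _) with orientation A B sep (s≤s order≤3)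
    ... | inj₁ τAB , _ = τAB
    ... | inj₂ τBA , _ = ⊥-elim (τ₀⇒¬τ-reversed t₀ τBA)

    τ⊆τ₀ : ∀ {A B} → τ A B → τ₀ G A B
    τ⊆τ₀ {A} {B} τAB with proj₁ tangle A B τAB
    ... | sep , order<4 with sides-differ sep (≤-pred order<4)
    ...   | inj₁ ∣A∣<∣B∣ = sep , ≤-pred order<4 , ∣A∣<∣B∣
    ...   | inj₂ ∣B∣<∣A∣ = ⊥-elim (τ₀⇒¬τ-reversed
            (IsSeparation-swap G sep , order-sym {A} {B} (≤-pred order<4) , ∣B∣<∣A∣) τAB)

proposition2p3 : ∀ {n : ℕ} (G : Graph n) → Internally4Connected G →
    (∀ A B → IsSeparation G A B → order G A B ≤ 3 →
       ∣ A ∣ < ∣ B ∣ ⊎ ∣ B ∣ < ∣ A ∣)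
    × IsTangle G 4 (τ₀ G)
    × (∀ τ → IsTangle G 4 τ → ∀ A B → τ A B ⇔ τ₀ G A B)
proposition2p3 G I4C =
    (λ _ _ → sides-differ I4C)
  , τ₀-isTangle I4C
  , λ _ tangle _ _ → mk⇔ (τ⊆τ₀ I4C tangle) (τ₀⊆τ I4C tangle)
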